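{- Let $q\ge2$, let $G$ be a rooted bipartite $(q+1)$-edge-colored graph, $S=\Psi(G)$, and let $i\ne j$ in $\{1,\dots,q\}$. If $S_{ij}$ is a forest, then for every color-$0$ edge of $G$, its two endpoints lie on a common color-$ij$ cycle of $G$.
   Context: A $(q+1)$-edge-colored graph is a finite connected multigraph with edge colors in $\{0,\dots,q\}$, each vertex incident to exactly one edge of each color; rooted = one color-$0$ edge distinguished and oriented; bipartite = vertices black/white with every edge joining black to white. A color-$ij$ cycle is a connected component of the subgraph of $G$ formed by the edges of colors $i$ and $j$. A $q$-constellation is a connected graph with white vertices, each of degree $q$ with one incident edge of each color $1,\dots,q$, and colored vertices, each carrying a color $i\in\{1,\dots,q\}$ and a cyclic order of its incident edges; each edge has a color $i$ and joins a white vertex to a color-$i$ vertex; one white vertex is the root. $\Psi$: orient all edges of $G$ black to white; contract every color-$0$ edge into a white vertex (root edge giving the root); for each $i$ the color-$i$ edges form disjoint directed cycles; replace each cycle on $p$ vertices by a new color-$i$ vertex joined by color-$i$ edges to these $p$ vertices in the cyclic order of the cycle. $S_{ij}$ is the subgraph of $S$ obtained by keeping only the edges of colors $i$ and $j$ (with their endpoints). -}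

module Defs where

open import Data.Nat using (ℕ; zero; suc; _≤_)
open import Data.Fin using (Fin; zero; suc; inject₁; fromℕ)
open import Data.Fin.Permutation using (Permutation′; _⟨$⟩ʳ_; _⟨$⟩ˡ_)
open import Data.Sum using (_⊎_; inj₁; inj₂)
open import Data.Product using (Σ; ∃; ∃-syntax; _×_; _,_)
open import Data.Bool using (Bool)
open import Data.Empty using (⊥)
open import Data.Unit using (⊤)
open import Relation.Binary.PropositionalEquality using (_≡_; _≢_)
open import Relation.Nullary using (¬_)
open import Function using (_∘_)

-- A graph is given by a vertex type V, an
-- equivalence _≈_ on V (vertex identity; used to model vertices that are
-- equivalence classes, e.g. cycles of a permutation) and an adjacency
-- relation E.

data Reach {V : Set} (E : V → V → Set) : V → V → Set where
  here  : ∀ {u} → Reach E u u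
  fwd   : ∀ {u v w} → E u v → Reach E v w → Reach E u w
  bwd   : ∀ {u v w} → E v u → Reach E v w → Reach E u w

Connected : (V : Set) → (V → V → Set) → Set
Connected V E = (u v : V) → Reach E u v

record GCycle {V : Set} (_≈_ : V → V → Set) (E : V → V → Set) : Set where
  field
    m        : ℕ
    long     : 2 ≤ m
    vert     : Fin (suc m) → V
    distinct : (s t : Fin (suc m)) → s ≢ t → ¬ (vert s ≈ vert t)
    path     : (t : Fin m) → E (vert (inject₁ t)) (vert (suc t))
    closing  : E (vert (fromℕ m)) (vert zero)

Forest : {V : Set} → (V → V → Set) → (V → V → Set) → Set
Forest _≈_ E = GCycle _≈_ E → ⊥

-- Black vertices: Fin n, white vertices: Fin n (each color class is a
-- perfect matching, so both sides have the same size).  For each color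
-- c ∈ {0,…,q}, the color-c edges are { (b , σ c ⟨$⟩ʳ b) | b black }, so
-- a color-c edge is identified by its black endpoint.

record BipColGraph (q : ℕ) : Set where
  field
    n     : ℕ
    σ     : Fin (suc q) → Permutation′ n

  -- vertices: inj₁ b black, inj₂ w white
  Vtx : Set
  Vtx = Fin n ⊎ Fin n

  EdgeCol : (Fin (suc q) → Set) → Vtx → Vtx → Set
  EdgeCol P (inj₁ b) (inj₂ w) = ∃[ c ] (P c × (σ c ⟨$⟩ʳ b ≡ w))
  EdgeCol P _        _        = ⊥

  Adj : Vtx → Vtx → Set
  Adj = EdgeCol (λ _ → ⊤)

  Adjij : Fin (suc q) → Fin (suc q) → Vtx → Vtx → Set
  Adjij i j = EdgeCol (λ c → (c ≡ i) ⊎ (c ≡ j))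

-- Rooted bipartite (q+1)-edge-colored graph: connected, with a
-- distinguished color-0 edge (given by its black endpoint) and an
-- orientation of it.
record RootedBipColGraph (q : ℕ) : Set where
  field
    graph     : BipColGraph q
  open BipColGraph graph public
  field
    connected : Connected Vtx Adj
    root      : Fin n
    rootOrientation : Bool

-- White vertices of S = color-0 edges of G, indexed by black endpoint b.
-- Orienting edges black → white, the color-c edge leaving (the black end
-- of) color-0 edge b enters white vertex σ c b, which is the white end of
-- color-0 edge σ 0 ⁻¹ (σ c b).  Hence the directed color-c cycles after
-- contraction are the cycles of the permutation πc = σ₀⁻¹ ∘ σ_c.

module Psi {q : ℕ} (G : BipColGraph q) where
  open BipColGraph G

  πc : Fin (suc q) → Fin n → Fin n
  πc c b = σ zero ⟨$⟩ˡ (σ c ⟨$⟩ʳ b)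

  iterC : Fin (suc q) → ℕ → Fin n → Fin n
  iterC c zero    x = x
  iterC c (suc k) x = πc c (iterC c k x)

  -- b and b' lie on the same color-c cycle (after contraction), i.e.
  -- are joined to the same color-c vertex of S.
  SameC : Fin (suc q) → Fin n → Fin n → Set
  SameC c x y = ∃[ k ] iterC c k x ≡ y

  -- Vertices of S_ij:
  --   inj₁ w               white vertex w
  --   inj₂ (inj₁ x)        the color-i vertex of the cycle of πc i through x
  --   inj₂ (inj₂ x)        the color-j vertex of the cycle of πc j through x
  -- (color vertices are cycles, represented by any of their members).
  SV : Set
  SV = Fin n ⊎ (Fin n ⊎ Fin n)

  module _ (i j : Fin (suc q)) where
    _≈S_ : SV → SV → Set
    inj₁ w         ≈S inj₁ w'         = w ≡ w'
    inj₂ (inj₁ x)  ≈S inj₂ (inj₁ x')  = SameC i x x'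
    inj₂ (inj₂ x)  ≈S inj₂ (inj₂ x')  = SameC j x x'
    _              ≈S _               = ⊥

    ES : SV → SV → Set
    ES (inj₁ w)        (inj₂ (inj₁ x)) = SameC i x w
    ES (inj₁ w)        (inj₂ (inj₂ x)) = SameC j x w
    ES (inj₂ (inj₁ x)) (inj₁ w)        = SameC i x w
    ES (inj₂ (inj₂ x)) (inj₁ w)        = SameC j x w
    ES _               _               = ⊥

    SijForest : Set
    SijForest = Forest _≈S_ ES

-- Put φ = σⱼ⁻¹ ∘ σᵢ, so that the color-ij cycle of G through the black vertex b visits
-- b, σᵢ b, φ b, σᵢ (φ b), φ² b, … .  If it never reaches the white end σ₀ b of the color-0 edge
-- at b, i.e. πᵢ (φᵗ b) ≠ b for all t, then, since πⱼ ∘ φ = πᵢ, following it in S gives a walk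
--   iVertex b — whiteS (πᵢ b) — jVertex (φ b) — whiteS (φ b) — iVertex (φ b) — … — jVertex b
-- that never passes through whiteS b.  Both ends of this walk are neighbours of whiteS b, so
-- erasing its loops and closing it up through whiteS b yields a cycle in S_ij.
module Submission where

open import Defs
open import Data.Nat using (ℕ; suc; _≤_)
open import Data.Fin using (Fin; zero; suc)
open import Data.Fin.Permutation using (_⟨$⟩ʳ_)
open import Data.Sum using (inj₁; inj₂)
open import Relation.Binary.PropositionalEquality using (_≢_)

open import Data.Nat using (zero; _+_; _*_; z≤n; s≤s; s<s⁻¹)
open import Data.Nat.Properties using (+-suc; +-comm; +-identityʳ; *-suc; m≤n⇒∃[o]m+o≡n; m≤m+n; n<1+n)
open import Data.Nat.GeneralisedArithmetic using (fold; fold-+; iterate; iterate-is-fold)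
open import Data.Fin as Fin using (toℕ; inject₁; fromℕ; fromℕ<; _≟_)
open import Data.Fin.Properties using (pigeonhole; any?; toℕ-fromℕ<; <-cmp)
open import Data.Fin.Permutation using (Permutation′; _⟨$⟩ˡ_; _∘ₚ_; flip; inverseʳ)
open import Data.List using (List; []; _∷_; length; lookup)
open import Data.List.Relation.Unary.All as All using (All; []; _∷_)
open import Data.List.Relation.Unary.All.Properties using (¬Any⇒All¬)
open import Data.List.Relation.Unary.Any using (Any; here; there)
open import Data.List.Relation.Unary.AllPairs using (AllPairs; []; _∷_)
open import Data.List.Relation.Unary.Linked using (Linked; [-]; _∷_)
open import Data.List.Membership.Propositional.Properties using (∈-lookup)
open import Data.Product using (∃-syntax; _×_; _,_)
open import Data.Empty using (⊥-elim)
open import Function using (_∘_)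
open import Function.Bundles using (Injection)
open import Function.Definitions using (Injective)
open import Function.Properties.Inverse using (↔⇒↣)
open import Relation.Binary.Definitions using (Reflexive; Symmetric; _Respectsˡ_; tri<; tri≈; tri>)
open import Relation.Nullary using (¬_; Dec; yes; no)
open import Relation.Nullary.Negation using (¬¬-map)
open import Relation.Nullary.Decidable using (¬¬-excluded-middle)
open import Relation.Binary.PropositionalEquality using (_≡_; refl; sym; trans; cong; subst; module ≡-Reasoning)

Orbit : {A : Set} → (A → A) → A → A → Set
Orbit f x y = ∃[ k ] fold x f k ≡ y

fold-periodic-multiple : {A : Set} (f : A → A) {x : A} {p : ℕ} → fold x f p ≡ x → ∀ m → fold x f (m * p) ≡ x
fold-periodic-multiple f         e zero    = refl
fold-periodic-multiple f {x} {p} e (suc m) = begin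
  fold x f (p + m * p)           ≡⟨ fold-+ x f p ⟩
  fold (fold x f (m * p)) f p    ≡⟨ cong (λ y → fold y f p) (fold-periodic-multiple f e m) ⟩
  fold x f p                     ≡⟨ e ⟩
  x                              ∎
  where open ≡-Reasoning

orbit-trans : {A : Set} (f : A → A) {x y w : A} → Orbit f x y → Orbit f y w → Orbit f x w
orbit-trans f {x} (k , refl) (l , refl) = l + k , fold-+ x f l

fold-injective : {A : Set} {f : A → A} → Injective _≡_ _≡_ f → ∀ k {x y} → fold x f k ≡ fold y f k → x ≡ y
fold-injective f-injective zero    e = e
fold-injective f-injective (suc k) e = fold-injective f-injective k (f-injective e)

module _ {n : ℕ} {f : Fin n → Fin n} (f-injective : Injective _≡_ _≡_ f) where

  fold-periodic : ∀ x → ∃[ r ] fold x f (suc r) ≡ x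
  fold-periodic x with pigeonhole (n<1+n n) (λ k → fold x f (toℕ k))
  ... | a , b , a<b , same with m≤n⇒∃[o]m+o≡n a<b
  ... | r , a+1+r≡b = r , sym (fold-injective f-injective (toℕ a) (begin
    fold x f (toℕ a)                   ≡⟨ same ⟩
    fold x f (toℕ b)                   ≡⟨ cong (fold x f) (trans (sym a+1+r≡b) (sym (+-suc (toℕ a) r))) ⟩
    fold x f (toℕ a + suc r)           ≡⟨ fold-+ x f (toℕ a) ⟩
    fold (fold x f (suc r)) f (toℕ a)  ∎))
    where open ≡-Reasoning

  orbit-sym : ∀ {x y} → Orbit f x y → Orbit f y x
  orbit-sym {x} (k , refl) with fold-periodic x
  ... | r , period = k * r , (begin
    fold (fold x f k) f (k * r)  ≡⟨ fold-+ x f (k * r) ⟨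
    fold x f (k * r + k)         ≡⟨ cong (fold x f) (trans (+-comm (k * r) k) (sym (*-suc k r))) ⟩
    fold x f (k * suc r)         ≡⟨ fold-periodic-multiple f period k ⟩
    x                            ∎)
    where open ≡-Reasoning

Linked-lookup : {V : Set} {R : V → V → Set} {x : V} {xs : List V} → Linked R (x ∷ xs) →
  (t : Fin (length xs)) → R (lookup (x ∷ xs) (inject₁ t)) (lookup (x ∷ xs) (suc t))
Linked-lookup (r ∷ _)  zero    = r
Linked-lookup (_ ∷ rs) (suc t) = Linked-lookup rs t

AllPairs-lookup : {V : Set} {R : V → V → Set} {xs : List V} → AllPairs R xs →
  {a b : Fin (length xs)} → a Fin.< b → R (lookup xs a) (lookup xs b)
AllPairs-lookup (rs ∷ _)  {zero}  {suc b} _   = All.lookup rs (∈-lookup b)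
AllPairs-lookup (_ ∷ rss) {suc a} {suc b} a<b = AllPairs-lookup rss (s<s⁻¹ a<b)

Avoiding : {V : Set} → (V → V → Set) → (V → V → Set) → V → V → V → Set
Avoiding _≈_ E z a b = ¬ z ≈ a × E a b × ¬ z ≈ b

module Graph {V : Set} {_≈_ : V → V → Set} {E : V → V → Set}
  (≈-refl : Reflexive _≈_) (≈-sym : Symmetric _≈_)
  (E-resp-≈ : E Respectsˡ _≈_) (E-sym : Symmetric E) where

  listCycle : (v : V) (vs : List V) → 2 ≤ length vs → Linked E (v ∷ vs) →
    AllPairs (λ a b → ¬ a ≈ b) (v ∷ vs) → E (lookup (v ∷ vs) (fromℕ (length vs))) v → GCycle _≈_ E
  listCycle v vs long linked distinct closing = record
    { m        = length vs
    ; long     = long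
    ; vert     = lookup (v ∷ vs)
    ; distinct = distinct′
    ; path     = Linked-lookup linked
    ; closing  = closing
    }
    where
    distinct′ : ∀ a b → a ≢ b → ¬ lookup (v ∷ vs) a ≈ lookup (v ∷ vs) b
    distinct′ a b a≢b with <-cmp a b
    ... | tri< a<b _ _ = AllPairs-lookup distinct a<b
    ... | tri≈ _ a≡b _ = ⊥-elim (a≢b a≡b)
    ... | tri> _ _ b<a = AllPairs-lookup distinct b<a ∘ ≈-sym

  module _ (z s : V) where

    -- A simple path from s to h avoiding z, listed from h back to s.
    record SimplePath (h : V) : Set where
      constructor simplePath
      field
        rest     : List V
        linked   : Linked E (h ∷ rest)
        distinct : AllPairs (λ a b → ¬ a ≈ b) (h ∷ rest)
        avoids   : All (λ a → ¬ z ≈ a) (h ∷ rest)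
        ends     : lookup (h ∷ rest) (fromℕ (length rest)) ≡ s

    PathTo : V → Set
    PathTo u = ∃[ h ] (u ≈ h × SimplePath h)

    shortcut : ∀ {h v} (p : SimplePath h) → Any (v ≈_) (h ∷ SimplePath.rest p) → PathTo v
    shortcut p (here v≈h) = _ , v≈h , p
    shortcut (simplePath (_ ∷ rest) (_ ∷ linked) (_ ∷ distinct) (_ ∷ avoids) ends) (there v∈rest) =
      shortcut (simplePath rest linked distinct avoids ends) v∈rest

    -- Loop erasure: v is either already on the path, which is then cut back to it, or is added
    -- to it.  Membership up to ≈ is not assumed decidable, hence the double negation.
    extend : ∀ {u v} → PathTo u → E u v → ¬ z ≈ v → ¬ ¬ PathTo v
    extend {u} {v} (h , u≈h , p@(simplePath rest linked distinct avoids ends)) e z≉v =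
      ¬¬-map grow ¬¬-excluded-middle
      where
      grow : Dec (Any (v ≈_) (h ∷ rest)) → PathTo v
      grow (yes v∈p) = shortcut p v∈p
      grow (no v∉p)  = v , ≈-refl , simplePath (h ∷ rest) (E-sym (E-resp-≈ u≈h e) ∷ linked)
        (¬Any⇒All¬ (h ∷ rest) v∉p ∷ distinct) (z≉v ∷ avoids) ends

    erase : ∀ {u t} → PathTo u → Reach (Avoiding _≈_ E z) u t → ¬ ¬ PathTo t
    erase p here                     k = k p
    erase p (fwd (_ , e , z≉v) walk) k = extend p e z≉v λ p′ → erase p′ walk k
    erase p (bwd (z≉v , e , _) walk) k = extend p (E-sym e) z≉v λ p′ → erase p′ walk k

    closeCycle : ∀ {t} → E z s → E z t → ¬ s ≈ t → PathTo t → GCycle _≈_ E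
    closeCycle zs zt s≉t (h , t≈h , simplePath [] _ _ _ refl) = ⊥-elim (s≉t (≈-sym t≈h))
    closeCycle zs zt s≉t (h , t≈h , simplePath (x ∷ rest) linked distinct avoids ends) =
      listCycle z (h ∷ x ∷ rest) (s≤s (s≤s z≤n))
        (E-sym (E-resp-≈ t≈h (E-sym zt)) ∷ linked)
        (avoids ∷ distinct)
        (subst (λ a → E a z) (sym ends) (E-sym zs))

    forest-separates-neighbours : Forest _≈_ E → ∀ {t} → E z s → E z t → ¬ s ≈ t →
      ¬ Reach (Avoiding _≈_ E z) s t
    forest-separates-neighbours forest zs zt s≉t walk =
      erase (s , ≈-refl , simplePath [] [-] ([] ∷ []) (start-avoids s≉t walk ∷ []) refl) walk
        (forest ∘ closeCycle zs zt s≉t)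
      where
      start-avoids : ∀ {t} → ¬ s ≈ t → Reach (Avoiding _≈_ E z) s t → ¬ z ≈ s
      start-avoids s≉s here                  = ⊥-elim (s≉s ≈-refl)
      start-avoids _   (fwd (z≉s , _ , _) _) = z≉s
      start-avoids _   (bwd (_ , _ , z≉s) _) = z≉s

permutation-injective : ∀ {n} (π : Permutation′ n) → Injective _≡_ _≡_ (π ⟨$⟩ʳ_)
permutation-injective π = Injection.injective (↔⇒↣ π)

pattern whiteS x  = inj₁ x
pattern iVertex x = inj₂ (inj₁ x)
pattern jVertex x = inj₂ (inj₂ x)

module ColoredGraph {q : ℕ} (G : BipColGraph q) where
  open BipColGraph G
  open Psi G

  πc-injective : ∀ c → Injective _≡_ _≡_ (πc c)
  πc-injective c = permutation-injective (σ c ∘ₚ flip (σ zero))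

  iterC-fold : ∀ c k x → iterC c k x ≡ fold x (πc c) k
  iterC-fold c zero    x = refl
  iterC-fold c (suc k) x = cong (πc c) (iterC-fold c k x)

  SameC⇒Orbit : ∀ {c x y} → SameC c x y → Orbit (πc c) x y
  SameC⇒Orbit {c} {x} (k , e) = k , trans (sym (iterC-fold c k x)) e

  Orbit⇒SameC : ∀ {c x y} → Orbit (πc c) x y → SameC c x y
  Orbit⇒SameC {c} {x} (k , e) = k , trans (iterC-fold c k x) e

  SameC-sym : ∀ {c x y} → SameC c x y → SameC c y x
  SameC-sym {c} = Orbit⇒SameC ∘ orbit-sym (πc-injective c) ∘ SameC⇒Orbit

  SameC-trans : ∀ {c x y w} → SameC c x y → SameC c y w → SameC c x w
  SameC-trans {c} p p′ = Orbit⇒SameC (orbit-trans (πc c) (SameC⇒Orbit p) (SameC⇒Orbit p′))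

  module _ (i j : Fin (suc q)) where

    ≈S-refl : Reflexive (_≈S_ i j)
    ≈S-refl {whiteS _}  = refl
    ≈S-refl {iVertex _} = 0 , refl
    ≈S-refl {jVertex _} = 0 , refl

    ≈S-sym : Symmetric (_≈S_ i j)
    ≈S-sym {whiteS _}  {whiteS _}  = sym
    ≈S-sym {iVertex _} {iVertex _} = SameC-sym
    ≈S-sym {jVertex _} {jVertex _} = SameC-sym

    ES-resp-≈S : ES i j Respectsˡ _≈S_ i j
    ES-resp-≈S {whiteS _}  {iVertex _} {iVertex _} x≈y  e = SameC-trans (SameC-sym x≈y) e
    ES-resp-≈S {whiteS _}  {jVertex _} {jVertex _} x≈y  e = SameC-trans (SameC-sym x≈y) e
    ES-resp-≈S {iVertex _} {whiteS _}  {whiteS _}  refl e = e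
    ES-resp-≈S {jVertex _} {whiteS _}  {whiteS _}  refl e = e
    ES-resp-≈S {whiteS _}  {whiteS _}  {whiteS _}  _    ()
    ES-resp-≈S {inj₂ _}    {iVertex _} _ ()
    ES-resp-≈S {inj₂ _}    {jVertex _} _ ()

    ES-sym : Symmetric (ES i j)
    ES-sym {whiteS _}  {iVertex _} e = e
    ES-sym {whiteS _}  {jVertex _} e = e
    ES-sym {iVertex _} {whiteS _}  e = e
    ES-sym {jVertex _} {whiteS _}  e = e

    φ : Fin n → Fin n
    φ = (σ i ∘ₚ flip (σ j)) ⟨$⟩ʳ_

    πc-φ : ∀ x → πc j (φ x) ≡ πc i x
    πc-φ x = cong (σ zero ⟨$⟩ˡ_) (inverseʳ (σ j))

    reach-iterate-φ : ∀ k x → Reach (Adjij i j) (inj₁ x) (inj₂ (σ i ⟨$⟩ʳ iterate φ x k))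
    reach-iterate-φ zero    x = fwd (i , inj₁ refl , refl) here
    reach-iterate-φ (suc k) x =
      fwd (i , inj₁ refl , refl) (bwd (j , inj₂ refl , inverseʳ (σ j)) (reach-iterate-φ k (φ x)))

    reach-color0-end : ∀ {b} k → b ≡ πc i (fold b φ k) → Reach (Adjij i j) (inj₁ b) (inj₂ (σ zero ⟨$⟩ʳ b))
    reach-color0-end {b} k hit = subst (Reach (Adjij i j) (inj₁ b) ∘ inj₂) ends-at-σ₀ (reach-iterate-φ k b)
      where
      open ≡-Reasoning
      ends-at-σ₀ : σ i ⟨$⟩ʳ iterate φ b k ≡ σ zero ⟨$⟩ʳ b
      ends-at-σ₀ = begin
        σ i ⟨$⟩ʳ iterate φ b k                ≡⟨ cong (σ i ⟨$⟩ʳ_) (iterate-is-fold b φ k) ⟨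
        σ i ⟨$⟩ʳ fold b φ k                   ≡⟨ inverseʳ (σ zero) ⟨
        σ zero ⟨$⟩ʳ πc i (fold b φ k)         ≡⟨ cong (σ zero ⟨$⟩ʳ_) hit ⟨
        σ zero ⟨$⟩ʳ b                         ∎

    module _ (b : Fin n) {r : ℕ} (returns : fold b φ (suc r) ≡ b)
             (misses : ∀ t → t ≤ r → b ≢ πc i (fold b φ t)) where

      WalkAvoiding-b : SV → SV → Set
      WalkAvoiding-b = Reach (Avoiding (_≈S_ i j) (ES i j) (whiteS b))

      walk-from-iVertex : ∀ t d → t + d ≡ r → WalkAvoiding-b (iVertex (fold b φ t)) (jVertex b)
      walk-from-jVertex : ∀ t d → t + d ≡ r → WalkAvoiding-b (jVertex (fold b φ (suc t))) (jVertex b)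

      walk-from-iVertex t d t+d≡r =
        fwd ((λ ()) , (1 , refl) , misses t t≤r)
          (fwd (misses t t≤r , (1 , πc-φ (fold b φ t)) , (λ ())) (walk-from-jVertex t d t+d≡r))
        where
        t≤r : t ≤ r
        t≤r = subst (t ≤_) t+d≡r (m≤m+n t d)

      walk-from-jVertex t d t+d≡r with fold b φ (suc t) ≟ b
      ... | yes back = subst (λ x → WalkAvoiding-b (jVertex x) (jVertex b)) (sym back) here
      walk-from-jVertex t zero t+0≡r | no ¬back =
        ⊥-elim (¬back (subst (λ u → fold b φ (suc u) ≡ b) (trans (sym t+0≡r) (+-identityʳ t)) returns))
      walk-from-jVertex t (suc d) t+d≡r | no ¬back =
        fwd ((λ ()) , (0 , refl) , ¬back ∘ sym)
          (fwd (¬back ∘ sym , (0 , refl) , (λ ())) (walk-from-iVertex (suc t) d (trans (sym (+-suc t d)) t+d≡r)))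

    color0-edge-in-ij-cycle : SijForest i j → ∀ b → Reach (Adjij i j) (inj₁ b) (inj₂ (σ zero ⟨$⟩ʳ b))
    color0-edge-in-ij-cycle forest b with fold-periodic (permutation-injective (σ i ∘ₚ flip (σ j))) b
    ... | r , returns with any? (λ (k : Fin (suc r)) → b ≟ πc i (fold b φ (toℕ k)))
    ... | yes (k , hit) = reach-color0-end (toℕ k) hit
    ... | no ¬hit = ⊥-elim (forest-separates-neighbours (whiteS b) (iVertex b) forest
                              (0 , refl) (0 , refl) (λ ()) (walk-from-iVertex b returns misses 0 r refl))
      where
      open Graph {_≈_ = _≈S_ i j} {E = ES i j} ≈S-refl ≈S-sym ES-resp-≈S ES-sym
      misses : ∀ t → t ≤ r → b ≢ πc i (fold b φ t)
      misses t t≤r hit = ¬hit (fromℕ< (s≤s t≤r) ,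
        subst (λ u → b ≡ πc i (fold b φ u)) (sym (toℕ-fromℕ< (s≤s t≤r))) hit)

lemma5p9 : (q : ℕ) → 2 ≤ q → (G : RootedBipColGraph q) → (i j : Fin q) → i ≢ j
    → Psi.SijForest (RootedBipColGraph.graph G) (suc i) (suc j)
    → (b : Fin (RootedBipColGraph.n G))
    → Reach (RootedBipColGraph.Adjij G (suc i) (suc j))
        (inj₁ b) (inj₂ (RootedBipColGraph.σ G zero ⟨$⟩ʳ b))
lemma5p9 q _ G i j _ = ColoredGraph.color0-edge-in-ij-cycle (RootedBipColGraph.graph G) (suc i) (suc j)
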